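{- Let $n\ge 2$ and $w=(a,u)\in S_n$. Then: (1) $\mathrm{rajcode}(w)$ is obtained by prepending the number $a+d_a(u)$ to $\mathrm{rajcode}(u)$; (2) $\mathrm{rajcode}(w^{ -1})$ is obtained from $\mathrm{rajcode}(u^{ -1})$ by inserting the number $d_a(u)$ between its $a$-th and $(a+1)$-th entries and then increasing each of the first $a$ entries by $1$. Consequently, $\mathrm{reg}(w)-\mathrm{reg}(u)=d_a(u)$.
   Context: A diagram is a finite subset of $\mathbb{Z}_{>0}\times\mathbb{Z}_{>0}$; $(r,c)$ is the cell in row $r$ (row 1 on top), column $c$. Weak compositions are sequences of nonnegative integers with finitely many nonzero entries; the row weight of a diagram is the weak composition counting cells in each row. For $v\in S_m$: $\mathrm{Rothe}(v)=\{(i,v(j)) : i<j,\ v(i)>v(j)\}$; $\mathrm{invcode}(v)$ is the weak composition with $i$-th entry $\#\{j>i : v(j)<v(i)\}$. For a diagram $D$, $\mathrm{dark}(D)$ is computed by scanning the rows from bottom to top: for row $r$, if there is $(r,c)\in D$ such that $\mathrm{dark}(D)$ currently contains no cell in column $c$, take the largest such $c$ and add $(r,c)$ to $\mathrm{dark}(D)$. The snow diagram of $v$ is obtained from $\mathrm{Rothe}(v)$ by adding, for each $(r,c)\in\mathrm{dark}(\mathrm{Rothe}(v))$, every cell $(r',c)$ with $r'<r$ not in $\mathrm{Rothe}(v)$; $\mathrm{rajcode}(v)$ is its row weight. $\mathrm{reg}(v)$ is the sum of entries of $\mathrm{rajcode}(v)$ minus the sum of entries of $\mathrm{invcode}(v)$.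 Notation $w=(a,u)$: for $w\in S_n$, $a=\mathrm{invcode}(w)_1$ and $u\in S_{n-1}$ is the unique permutation with $\mathrm{invcode}(u)=(\mathrm{invcode}(w)_2,\mathrm{invcode}(w)_3,\dots)$. For $u$ a permutation and $c\ge 0$, $d_c(u)$ is the number of cells of $\mathrm{dark}(\mathrm{Rothe}(u))$ lying in columns strictly greater than $c$. -}

module Defs where

open import Data.Nat using (ℕ; zero; suc; _+_; _≤ᵇ_; _<ᵇ_; _≡ᵇ_)
open import Data.Integer as ℤ using (ℤ; +_)
open import Data.Bool using (Bool; true; false; _∧_; _∨_; not; if_then_else_)
open import Data.Fin using (Fin; toℕ) renaming (zero to fzero; suc to fsuc)
open import Data.Fin.Permutation using (Permutation′; _⟨$⟩ʳ_; flip)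
open import Data.List using (List; []; _∷_; map; length; filterᵇ; reverse; findᵇ; foldr; sum; allFin)
open import Data.Bool.ListAction using (any)
open import Data.Maybe using (Maybe; just; nothing)
open import Data.Product using (_×_; _,_; proj₁; proj₂)
open import Function using (_∘_)

-- Conventions: a permutation of S_m is a bijection Fin m ↔ Fin m; the element
-- i : Fin m stands for the integer toℕ i + 1.  A cell (r , c) : Fin m × Fin m
-- stands for row toℕ r + 1, column toℕ c + 1.  All diagrams here live in the
-- m × m grid and are given by their (decidable) characteristic function.

Diagram : ℕ → Set
Diagram m = Fin m → Fin m → Bool

Cell : ℕ → Set
Cell m = Fin m × Fin m

_<F_ : ∀ {m} → Fin m → Fin m → Bool
i <F j = toℕ i <ᵇ toℕ j

_=F_ : ∀ {m} → Fin m → Fin m → Bool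
i =F j = toℕ i ≡ᵇ toℕ j

app : ∀ {m} → Permutation′ m → Fin m → Fin m
app v i = v ⟨$⟩ʳ i

inv : ∀ {m} → Permutation′ m → Permutation′ m
inv = flip

Rothe : ∀ {m} → Permutation′ m → Diagram m
Rothe {m} v r c =
  any (λ j → (r <F j) ∧ (app v j <F app v r) ∧ (app v j =F c)) (allFin m)

count : ∀ {A : Set} → (A → Bool) → List A → ℕ
count p xs = length (filterᵇ p xs)

darkStep : ∀ {m} → Diagram m → Fin m → List (Cell m) → List (Cell m)
darkStep {m} D r acc with
  findᵇ (λ c → D r c ∧ not (any (λ x → proj₂ x =F c) acc)) (reverse (allFin m))
... | nothing = acc
... | just c  = (r , c) ∷ acc

-- dark(D): scan rows from bottom (row m) to top (row 1); foldr over
-- [row 1, …, row m] applies darkStep to row m first.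
dark : ∀ {m} → Diagram m → List (Cell m)
dark {m} D = foldr (darkStep D) [] (allFin m)

snow : ∀ {m} → Permutation′ m → Diagram m
snow v r' c = Rothe v r' c ∨ any (λ x → (proj₂ x =F c) ∧ (r' <F proj₁ x)) (dark (Rothe v))

-- weak compositions are functions ℕ → ℕ; index k ∈ ℕ is the (k+1)-th entry
WeakComp : Set
WeakComp = ℕ → ℕ

ext : ∀ {m} → (Fin m → ℕ) → WeakComp
ext {zero}  f k       = 0
ext {suc m} f zero    = f fzero
ext {suc m} f (suc k) = ext (f ∘ fsuc) k

rowWeight : ∀ {m} → Diagram m → WeakComp
rowWeight {m} D = ext (λ r → count (D r) (allFin m))

invcode : ∀ {m} → Permutation′ m → WeakComp
invcode {m} v = ext (λ i → count (λ j → (i <F j) ∧ (app v j <F app v i)) (allFin m))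

rajcode : ∀ {m} → Permutation′ m → WeakComp
rajcode v = rowWeight (snow v)

sumUpTo : ℕ → WeakComp → ℕ
sumUpTo zero    f = 0
sumUpTo (suc m) f = f 0 + sumUpTo m (f ∘ suc)

reg : ∀ {m} → Permutation′ m → ℤ
reg {m} v = (+ sumUpTo m (rajcode v)) ℤ.- (+ sumUpTo m (invcode v))

-- d_c(u): number of cells of dark(Rothe(u)) in columns strictly greater than c
-- (column of (r , j) is toℕ j + 1, so the condition is c < toℕ j + 1)
d : ∀ {m} → ℕ → Permutation′ m → ℕ
d c u = count (λ x → c <ᵇ suc (toℕ (proj₂ x))) (dark (Rothe u))

prepend : ℕ → WeakComp → WeakComp
prepend x f zero    = x
prepend x f (suc k) = f k

-- insert x between the a-th and (a+1)-th entries, then add 1 to each of the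
-- first a entries
insertBump : ℕ → ℕ → WeakComp → WeakComp
insertBump zero    x f = prepend x f
insertBump (suc a) x f = prepend (suc (f 0)) (insertBump a x (f ∘ suc))

module Submission where

-- Write w = (a , u): w(1) = a + 1 and w(i + 1) is u(i) with the value a + 1 punched in.
-- Then Rothe(w) is Rothe(u) with an empty column a + 1 inserted and a new top row filling
-- columns 1 … a, while Rothe(w⁻¹), its transpose, is Rothe(u⁻¹) with an empty row a + 1
-- inserted and a new first column filling rows 1 … a.  Since dark takes the rightmost free
-- cell of each row, an empty inserted line or new cells left of all old columns leave the
-- old dark cells unchanged.  So snow(w) below its top row is snow(u), and the top row,
-- scanned last, holds its a Rothe cells plus the columns right of a + 1 carrying a dark
-- cell of u: a + d_a(u) cells.  Likewise snow(w⁻¹) is snow(u⁻¹) except that rows 1 … a gain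
-- their first-column cell and row a + 1 holds the columns of the dark cells of u⁻¹ below
-- it.  These are as many as the dark cells of u right of column a, because
-- dark(Dᵀ) = dark(D)ᵀ: the greedy matching that dark computes can equally be built column
-- by column.  The formula for reg is bookkeeping on (1).

open import Defs
open import Algebra.Properties.CommutativeSemigroup using (interchange; x∙yz≈y∙xz)
open import Data.Bool using (Bool; true; false; _∧_; _∨_; not; if_then_else_; T?)
open import Data.Bool.Properties using (not-injective; ∨-abs-∧; ⇔→≡; ∧-comm; ∧-zeroʳ; ∧-identityʳ; ∨-identityʳ; ∨-zeroʳ)
open import Data.Bool.ListAction using (any)
import Data.Integer as ℤ
import Data.Integer.Properties as ℤ
open import Data.Integer.Tactic.RingSolver using (solve-∀)
open import Data.Empty using (⊥; ⊥-elim)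
open import Data.Fin using (Fin; toℕ; punchIn; punchOut; _≟_) renaming (zero to fzero; suc to fsuc)
open import Data.Fin.Permutation using (Permutation′; remove; punchIn-permute; inverseˡ; inverseʳ)
open import Data.Fin.Properties using (toℕ-injective; punchInᵢ≢i; punchIn-punchOut; toℕ≤pred[n]; toℕ<n)
open import Data.List using (List; []; _∷_; _++_; map; filterᵇ; findᵇ; foldr; foldl; reverse; tabulate; allFin; _∷ʳ_; [_])
open import Data.List.Properties using (map-tabulate; reverse-map; unfold-reverse; foldl-ʳ++; ++-identityʳ)
open import Data.List.Relation.Binary.Permutation.Propositional using (_↭_; ↭-refl; ↭-trans; ↭-prep; ↭-swap; ↭-reflexive; module PermutationReasoning)
open import Data.List.Relation.Binary.Permutation.Propositional.Properties using (↭-length; filter-↭; shift)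
open import Data.Maybe using (Maybe; just; nothing; maybe′) renaming (map to mapMaybe)
open import Data.Nat using (ℕ; zero; suc; _≤_; _<_; _+_; _<ᵇ_; _≡ᵇ_; z≤n; s≤s)
open import Data.Nat.Properties using (+-commutativeSemigroup; +-identityʳ; ≤-refl; <⇒≤; <-≤-trans; <-cmp)
open import Data.Product using (_×_; _,_; proj₁; proj₂; Σ; swap)
open import Data.Sum using (_⊎_; inj₁; inj₂)
open import Data.Unit using (⊤; tt)
open import Function using (_∘_; id; flip; mk⇔)
open import Relation.Binary using (tri<; tri≈; tri>)
open import Relation.Binary.PropositionalEquality hiding ([_])
open import Relation.Nullary using (yes; no)

fromBool : Bool → ℕ
fromBool true  = 1
fromBool false = 0

countᶠ : ∀ m → (Fin m → Bool) → ℕ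
countᶠ zero    p = 0
countᶠ (suc m) p = fromBool (p fzero) + countᶠ m (p ∘ fsuc)

anyᶠ : ∀ m → (Fin m → Bool) → Bool
anyᶠ zero    p = false
anyᶠ (suc m) p = p fzero ∨ anyᶠ m (p ∘ fsuc)

count-∷ : ∀ {A : Set} (p : A → Bool) x xs → count p (x ∷ xs) ≡ fromBool (p x) + count p xs
count-∷ p x xs with p x
... | true  = refl
... | false = refl

count-tabulate : ∀ {A : Set} m (p : A → Bool) (f : Fin m → A) → count p (tabulate f) ≡ countᶠ m (p ∘ f)
count-tabulate zero    p f = refl
count-tabulate (suc m) p f =
  trans (count-∷ p (f fzero) _) (cong (fromBool (p (f fzero)) +_) (count-tabulate m p (f ∘ fsuc)))

any-tabulate : ∀ {A : Set} m (p : A → Bool) (f : Fin m → A) → any p (tabulate f) ≡ anyᶠ m (p ∘ f)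
any-tabulate zero    p f = refl
any-tabulate (suc m) p f = cong (p (f fzero) ∨_) (any-tabulate m p (f ∘ fsuc))

count-allFin : ∀ m (p : Fin m → Bool) → count p (allFin m) ≡ countᶠ m p
count-allFin m p = count-tabulate m p id

any-allFin : ∀ m (p : Fin m → Bool) → any p (allFin m) ≡ anyᶠ m p
any-allFin m p = any-tabulate m p id

count-↭ : ∀ {A : Set} (p : A → Bool) {xs ys : List A} → xs ↭ ys → count p xs ≡ count p ys
count-↭ p xs↭ys = ↭-length (filter-↭ (T? ∘ p) xs↭ys)

any-false : ∀ {A : Set} (xs : List A) → any (λ _ → false) xs ≡ false
any-false []       = refl
any-false (x ∷ xs) = any-false xs

true≢false : true ≢ false
true≢false ()

∧-≡true : ∀ {a b} → a ∧ b ≡ true → a ≡ true × b ≡ true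
∧-≡true {true} b≡true = refl , b≡true

fromBool-∨ : ∀ a b → a ∧ b ≡ false → fromBool (a ∨ b) ≡ fromBool a + fromBool b
fromBool-∨ true  false _ = refl
fromBool-∨ false b     _ = refl

fromBool-∨-not : ∀ a b → fromBool (a ∨ b) ≡ fromBool a + fromBool (not a ∧ b)
fromBool-∨-not true  b = refl
fromBool-∨-not false b = refl

any-∧-false : ∀ {A : Set} (q r : A → Bool) xs → any q xs ≡ false → any (λ y → q y ∧ r y) xs ≡ false
any-∧-false q r []       _ = refl
any-∧-false q r (x ∷ xs) e with q x
... | false = any-∧-false q r xs e

countᶠ-cong : ∀ m {p q : Fin m → Bool} → (∀ i → p i ≡ q i) → countᶠ m p ≡ countᶠ m q
countᶠ-cong zero    p≗q = refl
countᶠ-cong (suc m) p≗q = cong₂ _+_ (cong fromBool (p≗q fzero)) (countᶠ-cong m (p≗q ∘ fsuc))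

countᶠ-none : ∀ m {p : Fin m → Bool} → (∀ i → p i ≡ false) → countᶠ m p ≡ 0
countᶠ-none zero    none = refl
countᶠ-none (suc m) none rewrite none fzero = countᶠ-none m (none ∘ fsuc)

anyᶠ⇒∃ : ∀ m (p : Fin m → Bool) → anyᶠ m p ≡ true → Σ (Fin m) (λ i → p i ≡ true)
anyᶠ⇒∃ (suc m) p any-p with p fzero in p0
... | true  = fzero , p0
... | false with anyᶠ⇒∃ m (p ∘ fsuc) any-p
...   | i , pi = fsuc i , pi

∃⇒anyᶠ : ∀ m (p : Fin m → Bool) i → p i ≡ true → anyᶠ m p ≡ true
∃⇒anyᶠ (suc m) p fzero    pi rewrite pi = refl
∃⇒anyᶠ (suc m) p (fsuc i) pi rewrite ∃⇒anyᶠ m (p ∘ fsuc) i pi = ∨-zeroʳ (p fzero)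

countᶠ-punchIn : ∀ m (i : Fin (suc m)) (p : Fin (suc m) → Bool) →
                 countᶠ (suc m) p ≡ fromBool (p i) + countᶠ m (p ∘ punchIn i)
countᶠ-punchIn m       fzero    p = refl
countᶠ-punchIn (suc m) (fsuc i) p =
  trans (cong (fromBool (p fzero) +_) (countᶠ-punchIn m i (p ∘ fsuc)))
        (x∙yz≈y∙xz +-commutativeSemigroup (fromBool (p fzero)) (fromBool (p (fsuc i))) (countᶠ m (p ∘ fsuc ∘ punchIn i)))

countᶠ-+ : ∀ m {h f g : Fin m → Bool} → (∀ i → fromBool (h i) ≡ fromBool (f i) + fromBool (g i)) →
           countᶠ m h ≡ countᶠ m f + countᶠ m g
countᶠ-+ zero    split = refl
countᶠ-+ (suc m) {h} {f} {g} split =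
  trans (cong₂ _+_ (split fzero) (countᶠ-+ m (split ∘ fsuc)))
        (interchange +-commutativeSemigroup (fromBool (f fzero)) (fromBool (g fzero)) (countᶠ m (f ∘ fsuc)) (countᶠ m (g ∘ fsuc)))

<⇒<ᵇ≡true : ∀ {m n} → m < n → (m <ᵇ n) ≡ true
<⇒<ᵇ≡true {zero}  {suc n} _         = refl
<⇒<ᵇ≡true {suc m} {suc n} (s≤s m<n) = <⇒<ᵇ≡true m<n

<ᵇ≡true⇒< : ∀ {m n} → (m <ᵇ n) ≡ true → m < n
<ᵇ≡true⇒< {zero}  {suc n} _ = s≤s z≤n
<ᵇ≡true⇒< {suc m} {suc n} e = s≤s (<ᵇ≡true⇒< e)

≥⇒<ᵇ≡false : ∀ {m n} → n ≤ m → (m <ᵇ n) ≡ false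
≥⇒<ᵇ≡false {m}     {zero}  _         = refl
≥⇒<ᵇ≡false {suc m} {suc n} (s≤s n≤m) = ≥⇒<ᵇ≡false n≤m

<ᵇ≡false⇒≥ : ∀ {m n} → (m <ᵇ n) ≡ false → n ≤ m
<ᵇ≡false⇒≥ {m}     {zero}  _ = z≤n
<ᵇ≡false⇒≥ {suc m} {suc n} e = s≤s (<ᵇ≡false⇒≥ e)

<ᵇ-irrefl : ∀ m → (m <ᵇ m) ≡ false
<ᵇ-irrefl m = ≥⇒<ᵇ≡false (≤-refl {m})

<ᵇ-suc : ∀ m n → (m <ᵇ suc n) ≡ not (n <ᵇ m)
<ᵇ-suc zero    n       = refl
<ᵇ-suc (suc m) zero    = refl
<ᵇ-suc (suc m) (suc n) = <ᵇ-suc m n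

≡ᵇ≡true⇒≡ : ∀ {m n} → (m ≡ᵇ n) ≡ true → m ≡ n
≡ᵇ≡true⇒≡ {zero}  {zero}  _ = refl
≡ᵇ≡true⇒≡ {suc m} {suc n} e = cong suc (≡ᵇ≡true⇒≡ e)

≡ᵇ-refl : ∀ m → (m ≡ᵇ m) ≡ true
≡ᵇ-refl zero    = refl
≡ᵇ-refl (suc m) = ≡ᵇ-refl m

≡ᵇ-sym : ∀ m n → (m ≡ᵇ n) ≡ (n ≡ᵇ m)
≡ᵇ-sym zero    zero    = refl
≡ᵇ-sym zero    (suc n) = refl
≡ᵇ-sym (suc m) zero    = refl
≡ᵇ-sym (suc m) (suc n) = ≡ᵇ-sym m n

=F⇒≡ : ∀ {m} {i j : Fin m} → (i =F j) ≡ true → i ≡ j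
=F⇒≡ e = toℕ-injective (≡ᵇ≡true⇒≡ e)

=F-refl : ∀ {m} (i : Fin m) → (i =F i) ≡ true
=F-refl i = ≡ᵇ-refl (toℕ i)

≢⇒=F≡false : ∀ {m} {i j : Fin m} → i ≢ j → (i =F j) ≡ false
≢⇒=F≡false {i = i} {j} i≢j with i =F j in e
... | true  = ⊥-elim (i≢j (=F⇒≡ e))
... | false = refl

punchIn-<F : ∀ {m} (a : Fin (suc m)) (x y : Fin m) → (punchIn a x <F punchIn a y) ≡ (x <F y)
punchIn-<F fzero    x        y        = refl
punchIn-<F (fsuc a) fzero    fzero    = refl
punchIn-<F (fsuc a) fzero    (fsuc y) = refl
punchIn-<F (fsuc a) (fsuc x) fzero    = refl
punchIn-<F (fsuc a) (fsuc x) (fsuc y) = punchIn-<F a x y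

punchIn-=F : ∀ {m} (a : Fin (suc m)) (x y : Fin m) → (punchIn a x =F punchIn a y) ≡ (x =F y)
punchIn-=F fzero    x        y        = refl
punchIn-=F (fsuc a) fzero    fzero    = refl
punchIn-=F (fsuc a) fzero    (fsuc y) = refl
punchIn-=F (fsuc a) (fsuc x) fzero    = refl
punchIn-=F (fsuc a) (fsuc x) (fsuc y) = punchIn-=F a x y

punchInᵢ=Fi : ∀ {m} (a : Fin (suc m)) (x : Fin m) → (punchIn a x =F a) ≡ false
punchInᵢ=Fi fzero    x        = refl
punchInᵢ=Fi (fsuc a) fzero    = refl
punchInᵢ=Fi (fsuc a) (fsuc x) = punchInᵢ=Fi a x

punchIn-<ᵇ-pivot : ∀ {m} (a : Fin (suc m)) (x : Fin m) → (toℕ (punchIn a x) <ᵇ toℕ a) ≡ (toℕ x <ᵇ toℕ a)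
punchIn-<ᵇ-pivot fzero    x        = refl
punchIn-<ᵇ-pivot (fsuc a) fzero    = refl
punchIn-<ᵇ-pivot (fsuc a) (fsuc x) = punchIn-<ᵇ-pivot a x

pivot-<ᵇ-punchIn : ∀ {m} (a : Fin (suc m)) (x : Fin m) → (toℕ a <ᵇ toℕ (punchIn a x)) ≡ (toℕ a <ᵇ suc (toℕ x))
pivot-<ᵇ-punchIn fzero    x        = refl
pivot-<ᵇ-punchIn (fsuc a) fzero    = refl
pivot-<ᵇ-punchIn (fsuc a) (fsuc x) = pivot-<ᵇ-punchIn a x

ext-toℕ : ∀ {m} (f : Fin m → ℕ) (i : Fin m) → ext f (toℕ i) ≡ f i
ext-toℕ f fzero    = refl
ext-toℕ f (fsuc i) = ext-toℕ (f ∘ fsuc) i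

ext-cong : ∀ {m} {f g : Fin m → ℕ} → (∀ i → f i ≡ g i) → ∀ k → ext f k ≡ ext g k
ext-cong {zero}  f≗g k       = refl
ext-cong {suc m} f≗g zero    = f≗g fzero
ext-cong {suc m} f≗g (suc k) = ext-cong (f≗g ∘ fsuc) k

-- Lehmer codes

codeAt : ∀ {m} → Permutation′ m → Fin m → ℕ
codeAt {m} v i = count (λ j → (i <F j) ∧ (app v j <F app v i)) (allFin m)

countᶠ-permute : ∀ m (σ : Permutation′ m) (p : Fin m → Bool) → countᶠ m (p ∘ app σ) ≡ countᶠ m p
countᶠ-permute zero    σ p = refl
countᶠ-permute (suc m) σ p =
  trans (cong (fromBool (p (app σ fzero)) +_)
          (trans (countᶠ-cong m (λ j → cong p (punchIn-permute σ fzero j)))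
                 (countᶠ-permute m (remove fzero σ) (p ∘ punchIn (app σ fzero)))))
        (sym (countᶠ-punchIn m (app σ fzero) p))

countᶠ-<ᵇ : ∀ m n → n ≤ m → countᶠ m (λ c → toℕ c <ᵇ n) ≡ n
countᶠ-<ᵇ m       zero    _         = countᶠ-none m (λ _ → refl)
countᶠ-<ᵇ (suc m) (suc n) (s≤s n≤m) = cong suc (countᶠ-<ᵇ m n n≤m)

codeAt-zero : ∀ {m} (σ : Permutation′ (suc m)) → codeAt σ fzero ≡ toℕ (app σ fzero)
codeAt-zero {m} σ = begin
  codeAt σ fzero                                   ≡⟨ count-allFin (suc m) (λ j → (fzero <F j) ∧ (app σ j <F σ₀)) ⟩
  countᶠ m (λ j → app σ (fsuc j) <F σ₀)             ≡⟨ cong (λ b → fromBool b + countᶠ m (λ j → app σ (fsuc j) <F σ₀))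
                                                           (<ᵇ-irrefl (toℕ σ₀)) ⟨
  countᶠ (suc m) ((λ c → toℕ c <ᵇ toℕ σ₀) ∘ app σ)  ≡⟨ countᶠ-permute (suc m) σ (λ c → toℕ c <ᵇ toℕ σ₀) ⟩
  countᶠ (suc m) (λ c → toℕ c <ᵇ toℕ σ₀)            ≡⟨ countᶠ-<ᵇ (suc m) (toℕ σ₀) (<⇒≤ (toℕ<n σ₀)) ⟩
  toℕ σ₀                                           ∎
  where open ≡-Reasoning
        σ₀ : Fin (suc m)
        σ₀ = app σ fzero

codeAt-suc : ∀ {m} (σ : Permutation′ (suc m)) (i : Fin m) → codeAt σ (fsuc i) ≡ codeAt (remove fzero σ) i
codeAt-suc {m} σ i =
  trans (count-allFin (suc m) (λ j → (fsuc i <F j) ∧ (app σ j <F app σ (fsuc i))))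
   (trans (countᶠ-cong m (λ j → cong ((i <F j) ∧_)
             (trans (cong₂ _<F_ (punchIn-permute σ fzero j) (punchIn-permute σ fzero i)) (punchIn-<F (app σ fzero) _ _))))
          (sym (count-allFin m (λ j → (i <F j) ∧ (app σ′ j <F app σ′ i)))))
  where σ′ = remove fzero σ

codeAt-injective : ∀ m (σ τ : Permutation′ m) → (∀ i → codeAt σ i ≡ codeAt τ i) → ∀ i → app σ i ≡ app τ i
codeAt-injective (suc m) σ τ same fzero = toℕ-injective (trans (sym (codeAt-zero σ)) (trans (same fzero) (codeAt-zero τ)))
codeAt-injective (suc m) σ τ same (fsuc i) =
  trans (punchIn-permute σ fzero i)
   (trans (cong₂ punchIn (codeAt-injective (suc m) σ τ same fzero)
            (codeAt-injective m (remove fzero σ) (remove fzero τ)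
              (λ j → trans (sym (codeAt-suc σ j)) (trans (same (fsuc j)) (codeAt-suc τ j))) i))
          (sym (punchIn-permute τ fzero i)))

-- The dark construction

lastᶠ : ∀ m → (Fin m → Bool) → Maybe (Fin m)
lastᶠ zero    p = nothing
lastᶠ (suc m) p = maybe′ (just ∘ fsuc) (if p fzero then just fzero else nothing) (lastᶠ m (p ∘ fsuc))

findᵇ-++ : ∀ {A : Set} (p : A → Bool) xs ys → findᵇ p (xs ++ ys) ≡ maybe′ just (findᵇ p ys) (findᵇ p xs)
findᵇ-++ p []       ys = refl
findᵇ-++ p (x ∷ xs) ys with p x
... | true  = refl
... | false = findᵇ-++ p xs ys

findᵇ-map : ∀ {A B : Set} (p : B → Bool) (f : A → B) xs → findᵇ p (map f xs) ≡ mapMaybe f (findᵇ (p ∘ f) xs)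
findᵇ-map p f []       = refl
findᵇ-map p f (x ∷ xs) with p (f x)
... | true  = refl
... | false = findᵇ-map p f xs

reverse-allFin-suc : ∀ m → reverse (allFin (suc m)) ≡ map fsuc (reverse (allFin m)) ++ [ fzero ]
reverse-allFin-suc m = trans (unfold-reverse fzero (tabulate fsuc))
  (cong (_∷ʳ fzero) (trans (cong reverse (sym (map-tabulate id fsuc))) (sym (reverse-map fsuc (allFin m)))))

findᵇ-reverse-allFin : ∀ m (p : Fin m → Bool) → findᵇ p (reverse (allFin m)) ≡ lastᶠ m p
findᵇ-reverse-allFin zero    p = refl
findᵇ-reverse-allFin (suc m) p = begin
  findᵇ p (reverse (allFin (suc m)))                                      ≡⟨ cong (findᵇ p) (reverse-allFin-suc m) ⟩
  findᵇ p (map fsuc (reverse (allFin m)) ++ [ fzero ])                    ≡⟨ findᵇ-++ p (map fsuc (reverse (allFin m))) [ fzero ] ⟩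
  maybe′ just (findᵇ p [ fzero ]) (findᵇ p (map fsuc (reverse (allFin m))))
    ≡⟨ cong (maybe′ just (findᵇ p [ fzero ])) (findᵇ-map p fsuc (reverse (allFin m))) ⟩
  maybe′ just (findᵇ p [ fzero ]) (mapMaybe fsuc (findᵇ (p ∘ fsuc) (reverse (allFin m))))
    ≡⟨ maybe′-mapMaybe (findᵇ (p ∘ fsuc) (reverse (allFin m))) ⟩
  maybe′ (just ∘ fsuc) (findᵇ p [ fzero ]) (findᵇ (p ∘ fsuc) (reverse (allFin m)))
    ≡⟨ cong₂ (maybe′ (just ∘ fsuc)) (findᵇ-singleton (p fzero)) (findᵇ-reverse-allFin m (p ∘ fsuc)) ⟩
  lastᶠ (suc m) p                                                         ∎
  where
  open ≡-Reasoning
  maybe′-mapMaybe : ∀ x → maybe′ just (findᵇ p [ fzero ]) (mapMaybe fsuc x) ≡ maybe′ (just ∘ fsuc) (findᵇ p [ fzero ]) x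
  maybe′-mapMaybe (just x) = refl
  maybe′-mapMaybe nothing  = refl
  findᵇ-singleton : ∀ b → findᵇ (λ _ → b) [ fzero {m} ] ≡ (if b then just fzero else nothing)
  findᵇ-singleton true  = refl
  findᵇ-singleton false = refl

lastᶠ-satisfies : ∀ m (p : Fin m → Bool) {c} → lastᶠ m p ≡ just c → p c ≡ true
lastᶠ-satisfies (suc m) p e with lastᶠ m (p ∘ fsuc) in eq
lastᶠ-satisfies (suc m) p refl | just _ = lastᶠ-satisfies m (p ∘ fsuc) eq
lastᶠ-satisfies (suc m) p e    | nothing with p fzero in p0
lastᶠ-satisfies (suc m) p refl | nothing | true = p0

lastᶠ-nothing : ∀ m (p : Fin m → Bool) → lastᶠ m p ≡ nothing → ∀ c → p c ≡ false
lastᶠ-nothing (suc m) p e c with lastᶠ m (p ∘ fsuc) in eq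
lastᶠ-nothing (suc m) p () c | just _
... | nothing with p fzero in p0
lastᶠ-nothing (suc m) p () c        | nothing | true
lastᶠ-nothing (suc m) p e  fzero    | nothing | false = p0
lastᶠ-nothing (suc m) p e  (fsuc c) | nothing | false = lastᶠ-nothing m (p ∘ fsuc) eq c

lastᶠ-maximal : ∀ m (p : Fin m → Bool) {c} → lastᶠ m p ≡ just c → ∀ c′ → toℕ c < toℕ c′ → p c′ ≡ false
lastᶠ-maximal (suc m) p e c′ lt with lastᶠ m (p ∘ fsuc) in eq
lastᶠ-maximal (suc m) p refl fzero      ()        | just _
lastᶠ-maximal (suc m) p refl (fsuc c′) (s≤s lt)  | just _ = lastᶠ-maximal m (p ∘ fsuc) eq c′ lt
... | nothing with p fzero in p0
lastᶠ-maximal (suc m) p refl fzero      ()        | nothing | true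
lastᶠ-maximal (suc m) p refl (fsuc c′) lt        | nothing | true = lastᶠ-nothing m (p ∘ fsuc) eq c′

lastᶠ-none : ∀ m (p : Fin m → Bool) → (∀ c → p c ≡ false) → lastᶠ m p ≡ nothing
lastᶠ-none zero    p none = refl
lastᶠ-none (suc m) p none rewrite lastᶠ-none m (p ∘ fsuc) (none ∘ fsuc) | none fzero = refl

occupied : ∀ {m} → List (Cell m) → Fin m → Bool
occupied acc c = any (λ x → proj₂ x =F c) acc

darkCandidate : ∀ {m} → Diagram m → Fin m → List (Cell m) → Fin m → Bool
darkCandidate D r acc c = D r c ∧ not (occupied acc c)

addDark : ∀ {m} → Fin m → List (Cell m) → Maybe (Fin m) → List (Cell m)
addDark r acc = maybe′ (λ c → (r , c) ∷ acc) acc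

darkStep-findᵇ : ∀ {m} (D : Diagram m) r acc →
                 darkStep D r acc ≡ addDark r acc (findᵇ (darkCandidate D r acc) (reverse (allFin m)))
darkStep-findᵇ {m} D r acc with findᵇ (darkCandidate D r acc) (reverse (allFin m))
... | nothing = refl
... | just c  = refl

darkStep-lastᶠ : ∀ {m} (D : Diagram m) r acc → darkStep D r acc ≡ addDark r acc (lastᶠ m (darkCandidate D r acc))
darkStep-lastᶠ {m} D r acc =
  trans (darkStep-findᵇ D r acc) (cong (addDark r acc) (findᵇ-reverse-allFin m (darkCandidate D r acc)))

darkStep-emptyRow : ∀ {m} (D : Diagram m) r acc → (∀ c → D r c ≡ false) → darkStep D r acc ≡ acc
darkStep-emptyRow {m} D r acc empty
  rewrite darkStep-lastᶠ D r acc | lastᶠ-none m (darkCandidate D r acc) (λ c → cong (_∧ _) (empty c)) = refl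

darkStep-any : ∀ {m} (D : Diagram m) r acc (q : Cell m → Bool) → (∀ c → q (r , c) ≡ false) →
               any q (darkStep D r acc) ≡ any q acc
darkStep-any {m} D r acc q row-r rewrite darkStep-lastᶠ D r acc with lastᶠ m (darkCandidate D r acc)
... | nothing = refl
... | just c rewrite row-r c = refl

ColumnsDistinct : ∀ {m} → List (Cell m) → Set
ColumnsDistinct []       = ⊤
ColumnsDistinct (x ∷ xs) = (occupied xs (proj₂ x) ≡ false) × ColumnsDistinct xs

darkStep-columnsDistinct : ∀ {m} (D : Diagram m) r acc → ColumnsDistinct acc → ColumnsDistinct (darkStep D r acc)
darkStep-columnsDistinct {m} D r acc distinct rewrite darkStep-lastᶠ D r acc with lastᶠ m (darkCandidate D r acc) in eq
... | nothing = distinct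
... | just c  = not-injective (proj₂ (∧-≡true (lastᶠ-satisfies m (darkCandidate D r acc) eq))) , distinct

foldr-darkStep-columnsDistinct : ∀ {m} (D : Diagram m) rs → ColumnsDistinct (foldr (darkStep D) [] rs)
foldr-darkStep-columnsDistinct D []       = tt
foldr-darkStep-columnsDistinct D (r ∷ rs) = darkStep-columnsDistinct D r _ (foldr-darkStep-columnsDistinct D rs)

countᶠ-indicator : ∀ {m} (x : Fin m) (b : Bool) → countᶠ m (λ c → (x =F c) ∧ b) ≡ fromBool b
countᶠ-indicator {suc m} x b = begin
  countᶠ (suc m) (λ c → (x =F c) ∧ b)                     ≡⟨ countᶠ-punchIn m x (λ c → (x =F c) ∧ b) ⟩
  fromBool ((x =F x) ∧ b) + countᶠ m (λ c → (x =F punchIn x c) ∧ b)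
    ≡⟨ cong₂ _+_ (cong (λ e → fromBool (e ∧ b)) (=F-refl x)) (countᶠ-none m (λ c → cong (_∧ b) x≠punchIn)) ⟩
  fromBool b + 0                                          ≡⟨ +-identityʳ (fromBool b) ⟩
  fromBool b                                              ∎
  where
  open ≡-Reasoning
  x≠punchIn : ∀ {c} → (x =F punchIn x c) ≡ false
  x≠punchIn {c} = trans (≡ᵇ-sym (toℕ x) _) (punchInᵢ=Fi x c)

count-byColumn : ∀ {m} (L : List (Cell m)) → ColumnsDistinct L → ∀ (p : Cell m → Bool) →
                 count p L ≡ countᶠ m (λ c → any (λ x → (proj₂ x =F c) ∧ p x) L)
count-byColumn {m} []       _          p = sym (countᶠ-none m (λ _ → refl))
count-byColumn {m} (x ∷ xs) (x∉ , dxs) p =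
  trans (count-∷ p x xs)
   (trans (cong₂ _+_ (sym (countᶠ-indicator (proj₂ x) (p x))) (count-byColumn xs dxs p))
          (sym (countᶠ-+ m (λ c → fromBool-∨ ((proj₂ x =F c) ∧ p x) _ (disjoint c)))))
  where
  disjoint : ∀ c → ((proj₂ x =F c) ∧ p x) ∧ any (λ y → (proj₂ y =F c) ∧ p y) xs ≡ false
  disjoint c with proj₂ x =F c in e
  ... | false = refl
  ... | true = trans (cong (p x ∧_) (subst (λ z → any (λ y → (proj₂ y =F z) ∧ p y) xs ≡ false) (=F⇒≡ e)
                                           (any-∧-false (λ y → proj₂ y =F proj₂ x) p xs x∉)))
                     (∧-zeroʳ (p x))

module _ {m} (κ : Fin m → Fin (suc m))
  (κ-<F : ∀ x y → (κ x <F κ y) ≡ (x <F y))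
  (κ-image? : ∀ c′ → Σ (Fin m) (λ c → κ c ≡ c′) ⊎ (∀ c → κ c ≢ c′)) where

  data LastAlong (P′ : Fin (suc m) → Bool) (P : Fin m → Bool) : Maybe (Fin (suc m)) → Maybe (Fin m) → Set where
    none     : LastAlong P′ P nothing nothing
    inImage  : ∀ c → LastAlong P′ P (just (κ c)) (just c)
    offImage : ∀ c′ → (∀ c → κ c ≢ c′) → P′ c′ ≡ true → LastAlong P′ P (just c′) nothing

  lastᶠ-along : ∀ (P′ : Fin (suc m) → Bool) (P : Fin m → Bool) → (∀ c → P′ (κ c) ≡ P c) →
                (∀ c′ → (∀ c → κ c ≢ c′) → P′ c′ ≡ true → ∀ c → toℕ c′ < toℕ (κ c)) →
                LastAlong P′ P (lastᶠ (suc m) P′) (lastᶠ m P)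
  lastᶠ-along P′ P P′∘κ offLeft with lastᶠ (suc m) P′ in e′ | lastᶠ m P in e
  ... | nothing | nothing = none
  ... | nothing | just c  =
    ⊥-elim (true≢false (trans (sym (lastᶠ-satisfies m P e)) (trans (sym (P′∘κ c)) (lastᶠ-nothing (suc m) P′ e′ (κ c)))))
  ... | just c′ | nothing with κ-image? c′
  ...   | inj₁ (c , refl) =
    ⊥-elim (true≢false (trans (sym (lastᶠ-satisfies (suc m) P′ e′)) (trans (P′∘κ c) (lastᶠ-nothing m P e c))))
  ...   | inj₂ off = offImage c′ off (lastᶠ-satisfies (suc m) P′ e′)
  lastᶠ-along P′ P P′∘κ offLeft | just c′ | just c with κ-image? c′
  ... | inj₂ off =
    ⊥-elim (true≢false (trans (sym (trans (P′∘κ c) (lastᶠ-satisfies m P e)))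
                              (lastᶠ-maximal (suc m) P′ e′ (κ c) (offLeft c′ off (lastᶠ-satisfies (suc m) P′ e′) c))))
  ... | inj₁ (c₀ , refl) with <-cmp (toℕ c) (toℕ c₀)
  ...   | tri≈ _ c≡c₀ _ rewrite toℕ-injective c≡c₀ = inImage c₀
  ...   | tri< c<c₀ _ _ =
    ⊥-elim (true≢false (trans (sym (trans (sym (P′∘κ c₀)) (lastᶠ-satisfies (suc m) P′ e′))) (lastᶠ-maximal m P e c₀ c<c₀)))
  ...   | tri> _ _ c₀<c =
    ⊥-elim (true≢false (trans (sym (trans (P′∘κ c) (lastᶠ-satisfies m P e)))
                              (lastᶠ-maximal (suc m) P′ e′ (κ c) (<ᵇ≡true⇒< (trans (κ-<F c₀ c) (<⇒<ᵇ≡true c₀<c))))))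

-- Since dark takes the rightmost free candidate, new cells left of all columns of D are
-- taken only in rows where D offers none, so the dark cells of D survive transported (Lifts).
module DarkEmbedding {m} (D : Diagram m) (D′ : Diagram (suc m)) (ρ κ : Fin m → Fin (suc m))
  (κ-<F : ∀ x y → (κ x <F κ y) ≡ (x <F y))
  (κ-=F : ∀ x y → (κ x =F κ y) ≡ (x =F y))
  (κ-image? : ∀ c′ → Σ (Fin m) (λ c → κ c ≡ c′) ⊎ (∀ c → κ c ≢ c′))
  (D′-image : ∀ r c → D′ (ρ r) (κ c) ≡ D r c)
  (D′-offImage : ∀ r c′ → (∀ c → κ c ≢ c′) → D′ (ρ r) c′ ≡ true → ∀ c → toℕ c′ < toℕ (κ c)) where

  data Lifts : List (Cell (suc m)) → List (Cell m) → Set where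
    []    : Lifts [] []
    lift  : ∀ r c {xs′ xs} → Lifts xs′ xs → Lifts ((ρ r , κ c) ∷ xs′) ((r , c) ∷ xs)
    extra : ∀ r c′ {xs′ xs} → (∀ c → κ c ≢ c′) → D′ (ρ r) c′ ≡ true → Lifts xs′ xs → Lifts ((ρ r , c′) ∷ xs′) xs

  any-Lifts : ∀ (q′ : Cell (suc m) → Bool) (q : Cell m → Bool) →
              (∀ r c → q′ (ρ r , κ c) ≡ q (r , c)) →
              (∀ r c′ → (∀ c → κ c ≢ c′) → D′ (ρ r) c′ ≡ true → q′ (ρ r , c′) ≡ false) →
              ∀ {xs′ xs} → Lifts xs′ xs → any q′ xs′ ≡ any q xs
  any-Lifts q′ q on off []                   = refl
  any-Lifts q′ q on off (lift r c l)         = cong₂ _∨_ (on r c) (any-Lifts q′ q on off l)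
  any-Lifts q′ q on off (extra r c′ c′∉ d l) rewrite off r c′ c′∉ d = any-Lifts q′ q on off l

  darkCandidate-image : ∀ r {acc′ acc} → Lifts acc′ acc → ∀ c → darkCandidate D′ (ρ r) acc′ (κ c) ≡ darkCandidate D r acc c
  darkCandidate-image r l c = cong₂ _∧_ (D′-image r c)
    (cong not (any-Lifts (λ x → proj₂ x =F κ c) (λ x → proj₂ x =F c) (λ _ c₀ → κ-=F c₀ c)
                         (λ _ c′ c′∉ _ → ≢⇒=F≡false (λ e → c′∉ c (sym e))) l))

  darkCandidate-offImage : ∀ r acc′ c′ → (∀ c → κ c ≢ c′) → darkCandidate D′ (ρ r) acc′ c′ ≡ true →
                           ∀ c → toℕ c′ < toℕ (κ c)
  darkCandidate-offImage r acc′ c′ c′∉ cand = D′-offImage r c′ c′∉ (proj₁ (∧-≡true cand))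

  darkStep-Lifts : ∀ r {acc′ acc} → Lifts acc′ acc → Lifts (darkStep D′ (ρ r) acc′) (darkStep D r acc)
  darkStep-Lifts r {acc′} {acc} l
    rewrite darkStep-lastᶠ D′ (ρ r) acc′ | darkStep-lastᶠ D r acc
    with lastᶠ (suc m) (darkCandidate D′ (ρ r) acc′) | lastᶠ m (darkCandidate D r acc)
       | lastᶠ-along κ κ-<F κ-image? (darkCandidate D′ (ρ r) acc′) (darkCandidate D r acc)
                     (darkCandidate-image r l) (darkCandidate-offImage r acc′)
  ... | _ | _ | none                 = l
  ... | _ | _ | inImage c            = lift r c l
  ... | _ | _ | offImage c′ c′∉ cand = extra r c′ c′∉ (proj₁ (∧-≡true cand)) l

  data RowsMatch : List (Fin (suc m)) → List (Fin m) → Set where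
    []   : RowsMatch [] []
    keep : ∀ {x r rs′ rs} → x ≡ ρ r → RowsMatch rs′ rs → RowsMatch (x ∷ rs′) (r ∷ rs)
    skip : ∀ {x rs′ rs} → (∀ c′ → D′ x c′ ≡ false) → RowsMatch rs′ rs → RowsMatch (x ∷ rs′) rs

  foldr-darkStep-Lifts : ∀ {rs′ rs} → RowsMatch rs′ rs → Lifts (foldr (darkStep D′) [] rs′) (foldr (darkStep D) [] rs)
  foldr-darkStep-Lifts []               = []
  foldr-darkStep-Lifts (keep refl rows) = darkStep-Lifts _ (foldr-darkStep-Lifts rows)
  foldr-darkStep-Lifts (skip {x} {rs′} empty rows) =
    subst (λ acc → Lifts acc _) (sym (darkStep-emptyRow D′ x (foldr (darkStep D′) [] rs′) empty)) (foldr-darkStep-Lifts rows)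

  rowsMatch-tabulate : ∀ {k} (f : Fin k → Fin (suc m)) (g : Fin k → Fin m) → (∀ j → f j ≡ ρ (g j)) →
                       RowsMatch (tabulate f) (tabulate g)
  rowsMatch-tabulate {zero}  f g f≗ρg = []
  rowsMatch-tabulate {suc k} f g f≗ρg = keep (f≗ρg fzero) (rowsMatch-tabulate (f ∘ fsuc) (g ∘ fsuc) (f≗ρg ∘ fsuc))

  rowsMatch-punchIn : ∀ {k} (a : Fin (suc k)) (f : Fin (suc k) → Fin (suc m)) (g : Fin k → Fin m) →
                      (∀ j → f (punchIn a j) ≡ ρ (g j)) → (∀ c′ → D′ (f a) c′ ≡ false) → RowsMatch (tabulate f) (tabulate g)
  rowsMatch-punchIn fzero f g f≗ρg empty = skip empty (rowsMatch-tabulate (f ∘ fsuc) g f≗ρg)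
  rowsMatch-punchIn {suc k} (fsuc a) f g f≗ρg empty =
    keep (f≗ρg fzero) (rowsMatch-punchIn a (f ∘ fsuc) (g ∘ fsuc) (f≗ρg ∘ fsuc) empty)

-- Transposition

transpose : ∀ {m} → Diagram m → Diagram m
transpose D r c = D c r

without : ∀ {m} → Fin m → List (Fin m) → List (Fin m)
without c = filterᵇ (λ x → not (x =F c))

greedy : ∀ {m} → Diagram m → List (Fin m) → List (Fin m) → List (Cell m)
greedy D []       Cs = []
greedy D (r ∷ Rs) Cs = maybe′ (λ c → (r , c) ∷ greedy D Rs (without c Cs)) (greedy D Rs Cs) (findᵇ (D r) Cs)

Distinct : ∀ {m} → List (Fin m) → Set
Distinct []       = ⊤
Distinct (x ∷ xs) = (any (λ y → y =F x) xs ≡ false) × Distinct xs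

greedy-just : ∀ {m} (D : Diagram m) r Rs Cs {c} → findᵇ (D r) Cs ≡ just c →
              greedy D (r ∷ Rs) Cs ≡ (r , c) ∷ greedy D Rs (without c Cs)
greedy-just D r Rs Cs e = cong (maybe′ (λ c → (r , c) ∷ greedy D Rs (without c Cs)) (greedy D Rs Cs)) e

greedy-nothing : ∀ {m} (D : Diagram m) r Rs Cs → findᵇ (D r) Cs ≡ nothing → greedy D (r ∷ Rs) Cs ≡ greedy D Rs Cs
greedy-nothing D r Rs Cs e = cong (maybe′ (λ c → (r , c) ∷ greedy D Rs (without c Cs)) (greedy D Rs Cs)) e

findᵇ-cong : ∀ {A : Set} {p q : A → Bool} xs → (∀ x → p x ≡ q x) → findᵇ p xs ≡ findᵇ q xs
findᵇ-cong []                     p≗q = refl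
findᵇ-cong {p = p} {q} (x ∷ xs) p≗q rewrite p≗q x with q x
... | true  = refl
... | false = findᵇ-cong xs p≗q

greedy-cong : ∀ {m} {D E : Diagram m} → (∀ r c → D r c ≡ E r c) → ∀ Rs Cs → greedy D Rs Cs ≡ greedy E Rs Cs
greedy-cong             D≗E []       Cs = refl
greedy-cong {D = D} {E} D≗E (r ∷ Rs) Cs rewrite findᵇ-cong Cs (D≗E r) with findᵇ (E r) Cs
... | just c  = cong ((r , c) ∷_) (greedy-cong D≗E Rs (without c Cs))
... | nothing = greedy-cong D≗E Rs Cs

findᵇ-∷-true : ∀ {A : Set} (p : A → Bool) x xs → p x ≡ true → findᵇ p (x ∷ xs) ≡ just x
findᵇ-∷-true p x xs px rewrite px = refl

findᵇ-∷-false : ∀ {A : Set} (p : A → Bool) x xs → p x ≡ false → findᵇ p (x ∷ xs) ≡ findᵇ p xs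
findᵇ-∷-false p x xs px rewrite px = refl

findᵇ-just : ∀ {A : Set} (p : A → Bool) xs {c} → findᵇ p xs ≡ just c → p c ≡ true
findᵇ-just p (x ∷ xs) e with p x in px
findᵇ-just p (x ∷ xs) refl | true  = px
...                         | false = findᵇ-just p xs e

=F≡false-separated : ∀ {m} {x y : Fin m} (p : Fin m → Bool) → p x ≡ false → p y ≡ true → (x =F y) ≡ false
=F≡false-separated {x = x} {y} p px py with x =F y in e
... | false = refl
... | true  = ⊥-elim (true≢false (trans (sym py) (trans (cong p (sym (=F⇒≡ e))) px)))

any-without : ∀ {m} (x c : Fin m) xs → any (λ y → y =F x) xs ≡ false → any (λ y → y =F x) (without c xs) ≡ false
any-without x c []       _ = refl
any-without x c (y ∷ xs) e with y =F x in yx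
any-without x c (y ∷ xs) () | true
... | false with not (y =F c)
...   | true  rewrite yx = any-without x c xs e
...   | false = any-without x c xs e

without-distinct : ∀ {m} (c : Fin m) xs → Distinct xs → Distinct (without c xs)
without-distinct c []       _          = tt
without-distinct c (x ∷ xs) (x∉ , dxs) with x =F c
... | true  = without-distinct c xs dxs
... | false = any-without x c xs x∉ , without-distinct c xs dxs

without-∉ : ∀ {m} (c : Fin m) xs → any (λ y → y =F c) xs ≡ false → without c xs ≡ xs
without-∉ c []       _ = refl
without-∉ c (x ∷ xs) e with x =F c
without-∉ c (x ∷ xs) () | true
... | false = cong (x ∷_) (without-∉ c xs e)

without-head : ∀ {m} (x : Fin m) xs → any (λ y → y =F x) xs ≡ false → without x (x ∷ xs) ≡ xs
without-head x xs x∉ rewrite =F-refl x = without-∉ x xs x∉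

without-∷ : ∀ {m} {x c : Fin m} xs → (x =F c) ≡ false → without c (x ∷ xs) ≡ x ∷ without c xs
without-∷ xs x≠c rewrite x≠c = refl

columnFirst : ∀ {m} → Diagram m → List (Fin m) → Fin m → List (Fin m) → Maybe (Fin m) → List (Cell m)
columnFirst D Rs C Cs = maybe′ (λ r → (r , C) ∷ greedy D (without r Rs) Cs) (greedy D Rs Cs)

greedy-byColumn-hit : ∀ {m} (D : Diagram m) R Rs C Cs → any (λ y → y =F R) Rs ≡ false → Distinct (C ∷ Cs) →
                      D R C ≡ true →
                      greedy D (R ∷ Rs) (C ∷ Cs) ≡ columnFirst D (R ∷ Rs) C Cs (findᵇ (transpose D C) (R ∷ Rs))
greedy-byColumn-hit D R Rs C Cs R∉ (C∉ , _) RC = begin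
  greedy D (R ∷ Rs) (C ∷ Cs)                    ≡⟨ greedy-just D R Rs (C ∷ Cs) (findᵇ-∷-true (D R) C Cs RC) ⟩
  (R , C) ∷ greedy D Rs (without C (C ∷ Cs))    ≡⟨ cong (λ cs → (R , C) ∷ greedy D Rs cs) (without-head C Cs C∉) ⟩
  (R , C) ∷ greedy D Rs Cs                      ≡⟨ cong (λ rs → (R , C) ∷ greedy D rs Cs) (without-head R Rs R∉) ⟨
  (R , C) ∷ greedy D (without R (R ∷ Rs)) Cs    ≡⟨ cong (columnFirst D (R ∷ Rs) C Cs) (findᵇ-∷-true (transpose D C) R Rs RC) ⟨
  columnFirst D (R ∷ Rs) C Cs (findᵇ (transpose D C) (R ∷ Rs)) ∎
  where open ≡-Reasoning

without-firstRow : ∀ {m} (D : Diagram m) R Rs C {r} → D R C ≡ false → findᵇ (transpose D C) Rs ≡ just r →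
                   without r (R ∷ Rs) ≡ R ∷ without r Rs
without-firstRow D R Rs C RC eC = without-∷ Rs (=F≡false-separated (transpose D C) RC (findᵇ-just (transpose D C) Rs eC))

columnFirst-idleRow : ∀ {m} (D : Diagram m) R Rs C Cs → D R C ≡ false → findᵇ (D R) Cs ≡ nothing →
                      ∀ y → findᵇ (transpose D C) Rs ≡ y → columnFirst D Rs C Cs y ≡ columnFirst D (R ∷ Rs) C Cs y
columnFirst-idleRow D R Rs C Cs RC eR nothing  _  = sym (greedy-nothing D R Rs Cs eR)
columnFirst-idleRow D R Rs C Cs RC eR (just r) eC = cong ((r , C) ∷_) (begin
  greedy D (without r Rs) Cs        ≡⟨ greedy-nothing D R (without r Rs) Cs eR ⟨
  greedy D (R ∷ without r Rs) Cs    ≡⟨ cong (λ rs → greedy D rs Cs) (without-firstRow D R Rs C RC eC) ⟨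
  greedy D (without r (R ∷ Rs)) Cs  ∎)
  where open ≡-Reasoning

columnFirst-busyRow : ∀ {m} (D : Diagram m) R Rs C Cs {c} → D R C ≡ false → findᵇ (D R) Cs ≡ just c →
                      ∀ y → findᵇ (transpose D C) Rs ≡ y →
                      (R , c) ∷ columnFirst D Rs C (without c Cs) y ↭ columnFirst D (R ∷ Rs) C Cs y
columnFirst-busyRow D R Rs C Cs RC eR nothing  _  = ↭-reflexive (sym (greedy-just D R Rs Cs eR))
columnFirst-busyRow D R Rs C Cs {c} RC eR (just r) eC = begin
  (R , c) ∷ (r , C) ∷ greedy D (without r Rs) (without c Cs) ↭⟨ ↭-swap (R , c) (r , C) ↭-refl ⟩
  (r , C) ∷ (R , c) ∷ greedy D (without r Rs) (without c Cs) ≡⟨ cong ((r , C) ∷_) (greedy-just D R (without r Rs) Cs eR) ⟨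
  (r , C) ∷ greedy D (R ∷ without r Rs) Cs                   ≡⟨ cong (λ rs → (r , C) ∷ greedy D rs Cs) (without-firstRow D R Rs C RC eC) ⟨
  (r , C) ∷ greedy D (without r (R ∷ Rs)) Cs                 ∎
  where open PermutationReasoning

greedy-byColumn-miss : ∀ {m} (D : Diagram m) R Rs C Cs → Distinct (C ∷ Cs) → D R C ≡ false →
  (∀ Cs′ → Distinct (C ∷ Cs′) → greedy D Rs (C ∷ Cs′) ↭ columnFirst D Rs C Cs′ (findᵇ (transpose D C) Rs)) →
  greedy D (R ∷ Rs) (C ∷ Cs) ↭ columnFirst D (R ∷ Rs) C Cs (findᵇ (transpose D C) Rs)
greedy-byColumn-miss D R Rs C Cs (C∉ , dCs) RC IH = byRowFirst (findᵇ (D R) Cs) refl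
  where
  open PermutationReasoning
  y = findᵇ (transpose D C) Rs
  byRowFirst : ∀ x → findᵇ (D R) Cs ≡ x → greedy D (R ∷ Rs) (C ∷ Cs) ↭ columnFirst D (R ∷ Rs) C Cs y
  byRowFirst nothing eR = begin
    greedy D (R ∷ Rs) (C ∷ Cs)     ≡⟨ greedy-nothing D R Rs (C ∷ Cs) (trans (findᵇ-∷-false (D R) C Cs RC) eR) ⟩
    greedy D Rs (C ∷ Cs)           ↭⟨ IH Cs (C∉ , dCs) ⟩
    columnFirst D Rs C Cs y        ≡⟨ columnFirst-idleRow D R Rs C Cs RC eR y refl ⟩
    columnFirst D (R ∷ Rs) C Cs y  ∎
  byRowFirst (just c) eR = begin
    greedy D (R ∷ Rs) (C ∷ Cs)                     ≡⟨ greedy-just D R Rs (C ∷ Cs) (trans (findᵇ-∷-false (D R) C Cs RC) eR) ⟩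
    (R , c) ∷ greedy D Rs (without c (C ∷ Cs))     ≡⟨ cong (λ cs → (R , c) ∷ greedy D Rs cs)
                                                           (without-∷ Cs (=F≡false-separated (D R) RC (findᵇ-just (D R) Cs eR))) ⟩
    (R , c) ∷ greedy D Rs (C ∷ without c Cs)       ↭⟨ ↭-prep (R , c) (IH (without c Cs) (any-without C c Cs C∉ , without-distinct c Cs dCs)) ⟩
    (R , c) ∷ columnFirst D Rs C (without c Cs) y  ↭⟨ columnFirst-busyRow D R Rs C Cs RC eR y refl ⟩
    columnFirst D (R ∷ Rs) C Cs y                  ∎

-- The greedy choice can equally be made column by column: the first column C is taken by the
-- first row of Rs containing it.
greedy-byColumn : ∀ {m} (D : Diagram m) Rs C Cs → Distinct Rs → Distinct (C ∷ Cs) →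
                  greedy D Rs (C ∷ Cs) ↭ columnFirst D Rs C Cs (findᵇ (transpose D C) Rs)
greedy-byColumn D []       C Cs _          _    = ↭-refl
greedy-byColumn D (R ∷ Rs) C Cs (R∉ , dRs) dCCs = byHead (D R C) refl
  where
  byHead : ∀ b → D R C ≡ b → greedy D (R ∷ Rs) (C ∷ Cs) ↭ columnFirst D (R ∷ Rs) C Cs (findᵇ (transpose D C) (R ∷ Rs))
  byHead true  RC = ↭-reflexive (greedy-byColumn-hit D R Rs C Cs R∉ dCCs RC)
  byHead false RC = ↭-trans (greedy-byColumn-miss D R Rs C Cs dCCs RC (λ Cs′ → greedy-byColumn D Rs C Cs′ dRs))
                            (↭-reflexive (cong (columnFirst D (R ∷ Rs) C Cs) (sym (findᵇ-∷-false (transpose D C) R Rs RC))))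

greedy-transpose : ∀ {m} (D : Diagram m) Rs Cs → Distinct Rs → Distinct Cs →
                   greedy D Rs Cs ↭ map swap (greedy (transpose D) Cs Rs)
greedy-transpose D Rs []       dRs _          = ↭-reflexive (greedy-[] Rs)
  where greedy-[] : ∀ Rs → greedy D Rs [] ≡ []
        greedy-[] []       = refl
        greedy-[] (r ∷ Rs) = greedy-[] Rs
greedy-transpose D Rs (C ∷ Cs) dRs (C∉ , dCs) = byColumnFirst (findᵇ (transpose D C) Rs) refl
  where
  open PermutationReasoning
  byColumnFirst : ∀ y → findᵇ (transpose D C) Rs ≡ y → greedy D Rs (C ∷ Cs) ↭ map swap (greedy (transpose D) (C ∷ Cs) Rs)
  byColumnFirst nothing eC = begin
    greedy D Rs (C ∷ Cs)                         ↭⟨ greedy-byColumn D Rs C Cs dRs (C∉ , dCs) ⟩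
    columnFirst D Rs C Cs (findᵇ (transpose D C) Rs) ≡⟨ cong (columnFirst D Rs C Cs) eC ⟩
    greedy D Rs Cs                               ↭⟨ greedy-transpose D Rs Cs dRs dCs ⟩
    map swap (greedy (transpose D) Cs Rs)         ≡⟨ cong (map swap) (greedy-nothing (transpose D) C Cs Rs eC) ⟨
    map swap (greedy (transpose D) (C ∷ Cs) Rs)   ∎
  byColumnFirst (just r) eC = begin
    greedy D Rs (C ∷ Cs)                         ↭⟨ greedy-byColumn D Rs C Cs dRs (C∉ , dCs) ⟩
    columnFirst D Rs C Cs (findᵇ (transpose D C) Rs) ≡⟨ cong (columnFirst D Rs C Cs) eC ⟩
    (r , C) ∷ greedy D (without r Rs) Cs
      ↭⟨ ↭-prep (r , C) (greedy-transpose D (without r Rs) Cs (without-distinct r Rs dRs) dCs) ⟩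
    (r , C) ∷ map swap (greedy (transpose D) Cs (without r Rs)) ≡⟨ cong (map swap) (greedy-just (transpose D) C Cs Rs eC) ⟨
    map swap (greedy (transpose D) (C ∷ Cs) Rs)   ∎

free : ∀ {m} → List (Cell m) → List (Fin m)
free {m} acc = filterᵇ (λ c → not (occupied acc c)) (reverse (allFin m))

filterᵇ-occupied-∷ : ∀ {m} r c (acc : List (Cell m)) xs →
  filterᵇ (λ x → not (occupied ((r , c) ∷ acc) x)) xs ≡ without c (filterᵇ (λ x → not (occupied acc x)) xs)
filterᵇ-occupied-∷ r c acc []       = refl
filterᵇ-occupied-∷ r c acc (x ∷ xs) rewrite ≡ᵇ-sym (toℕ c) (toℕ x) with occupied acc x
... | true  rewrite ∨-zeroʳ (x =F c) = filterᵇ-occupied-∷ r c acc xs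
... | false rewrite ∨-identityʳ (x =F c) with x =F c
...   | true  = filterᵇ-occupied-∷ r c acc xs
...   | false = cong (x ∷_) (filterᵇ-occupied-∷ r c acc xs)

findᵇ-filterᵇ : ∀ {A : Set} (p q : A → Bool) xs → findᵇ p (filterᵇ q xs) ≡ findᵇ (λ x → p x ∧ q x) xs
findᵇ-filterᵇ p q []       = refl
findᵇ-filterᵇ p q (x ∷ xs) with q x
... | true with p x
...   | true  = refl
...   | false = findᵇ-filterᵇ p q xs
findᵇ-filterᵇ p q (x ∷ xs) | false rewrite ∧-zeroʳ (p x) = findᵇ-filterᵇ p q xs

filterᵇ-true : ∀ {A : Set} (xs : List A) → filterᵇ (λ _ → true) xs ≡ xs
filterᵇ-true []       = refl
filterᵇ-true (x ∷ xs) = cong (x ∷_) (filterᵇ-true xs)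

foldl-darkStep : ∀ {m} (D : Diagram m) Rs acc → foldl (flip (darkStep D)) acc Rs ↭ greedy D Rs (free acc) ++ acc
foldl-darkStep D []       acc = ↭-refl
foldl-darkStep {m} D (r ∷ Rs) acc = byCandidate (findᵇ (darkCandidate D r acc) (reverse (allFin m))) refl
  where
  open PermutationReasoning
  unfoldStep : ∀ {x} → findᵇ (darkCandidate D r acc) (reverse (allFin m)) ≡ x →
         foldl (flip (darkStep D)) acc (r ∷ Rs) ≡ foldl (flip (darkStep D)) (addDark r acc x) Rs
  unfoldStep e = cong (λ acc′ → foldl (flip (darkStep D)) acc′ Rs) (trans (darkStep-findᵇ D r acc) (cong (addDark r acc) e))
  rowFirst : ∀ {x} → findᵇ (darkCandidate D r acc) (reverse (allFin m)) ≡ x → findᵇ (D r) (free acc) ≡ x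
  rowFirst = trans (findᵇ-filterᵇ (D r) _ (reverse (allFin m)))
  byCandidate : ∀ x → findᵇ (darkCandidate D r acc) (reverse (allFin m)) ≡ x →
                foldl (flip (darkStep D)) acc (r ∷ Rs) ↭ greedy D (r ∷ Rs) (free acc) ++ acc
  byCandidate nothing e = begin
    foldl (flip (darkStep D)) acc (r ∷ Rs) ≡⟨ unfoldStep e ⟩
    foldl (flip (darkStep D)) acc Rs       ↭⟨ foldl-darkStep D Rs acc ⟩
    greedy D Rs (free acc) ++ acc          ≡⟨ cong (_++ acc) (greedy-nothing D r Rs (free acc) (rowFirst e)) ⟨
    greedy D (r ∷ Rs) (free acc) ++ acc    ∎
  byCandidate (just c) e = begin
    foldl (flip (darkStep D)) acc (r ∷ Rs)              ≡⟨ unfoldStep e ⟩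
    foldl (flip (darkStep D)) ((r , c) ∷ acc) Rs        ↭⟨ foldl-darkStep D Rs ((r , c) ∷ acc) ⟩
    greedy D Rs (free ((r , c) ∷ acc)) ++ (r , c) ∷ acc ≡⟨ cong (λ cs → greedy D Rs cs ++ (r , c) ∷ acc)
                                                                (filterᵇ-occupied-∷ r c acc (reverse (allFin m))) ⟩
    greedy D Rs (without c (free acc)) ++ (r , c) ∷ acc ↭⟨ shift (r , c) (greedy D Rs (without c (free acc))) acc ⟩
    (r , c) ∷ greedy D Rs (without c (free acc)) ++ acc ≡⟨ cong (_++ acc) (greedy-just D r Rs (free acc) (rowFirst e)) ⟨
    greedy D (r ∷ Rs) (free acc) ++ acc                 ∎

dark-greedy : ∀ {m} (D : Diagram m) → dark D ↭ greedy D (reverse (allFin m)) (reverse (allFin m))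
dark-greedy {m} D = begin
  foldr (darkStep D) [] (allFin m)                      ≡⟨ foldl-ʳ++ (flip (darkStep D)) [] (allFin m) ⟨
  foldl (flip (darkStep D)) [] (reverse (allFin m))     ↭⟨ foldl-darkStep D (reverse (allFin m)) [] ⟩
  greedy D (reverse (allFin m)) (free []) ++ []         ≡⟨ ++-identityʳ _ ⟩
  greedy D (reverse (allFin m)) (free [])               ≡⟨ cong (greedy D (reverse (allFin m))) (filterᵇ-true (reverse (allFin m))) ⟩
  greedy D (reverse (allFin m)) (reverse (allFin m))    ∎
  where open PermutationReasoning

distinct-reverse-allFin : ∀ m → Distinct (reverse (allFin m))
distinct-reverse-allFin zero    = tt
distinct-reverse-allFin (suc m) =
  subst Distinct (sym (reverse-allFin-suc m)) (distinct-map-fsuc-∷ʳ _ (distinct-reverse-allFin m))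
  where
  any-map-fsuc : ∀ {k} (x : Fin k) xs → any (λ y → y =F fsuc x) (map fsuc xs ++ [ fzero ]) ≡ any (λ y → y =F x) xs
  any-map-fsuc x []       = refl
  any-map-fsuc x (y ∷ xs) = cong ((y =F x) ∨_) (any-map-fsuc x xs)
  distinct-map-fsuc-∷ʳ : ∀ {k} (xs : List (Fin k)) → Distinct xs → Distinct (map fsuc xs ++ [ fzero ])
  distinct-map-fsuc-∷ʳ []       _          = refl , tt
  distinct-map-fsuc-∷ʳ (x ∷ xs) (x∉ , dxs) = trans (any-map-fsuc x xs) x∉ , distinct-map-fsuc-∷ʳ xs dxs

count-map : ∀ {A B : Set} (f : A → B) (p : B → Bool) xs → count p (map f xs) ≡ count (p ∘ f) xs
count-map f p []       = refl
count-map f p (x ∷ xs) =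
  trans (count-∷ p (f x) (map f xs)) (trans (cong (fromBool (p (f x)) +_) (count-map f p xs)) (sym (count-∷ (p ∘ f) x xs)))

-- The counting form of dark(Dᵀ) = dark(D)ᵀ as multisets.
count-dark-transpose : ∀ {m} (D E : Diagram m) → (∀ r c → E r c ≡ D c r) → ∀ p → count p (dark E) ≡ count (p ∘ swap) (dark D)
count-dark-transpose {m} D E E≗Dᵀ p = begin
  count p (dark E)                                     ≡⟨ count-↭ p (dark-greedy E) ⟩
  count p (greedy E rv rv)                             ≡⟨ cong (count p) (greedy-cong E≗Dᵀ rv rv) ⟩
  count p (greedy (transpose D) rv rv)                 ≡⟨ count-↭ p (greedy-transpose (transpose D) rv rv distinct distinct) ⟩
  count p (map swap (greedy D rv rv))                  ≡⟨ count-map swap p (greedy D rv rv) ⟩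
  count (p ∘ swap) (greedy D rv rv)                    ≡⟨ count-↭ (p ∘ swap) (dark-greedy D) ⟨
  count (p ∘ swap) (dark D)                            ∎
  where
  open ≡-Reasoning
  rv = reverse (allFin m)
  distinct = distinct-reverse-allFin m

-- Rothe diagrams

Rothe-anyᶠ : ∀ {m} (v : Permutation′ m) r c → Rothe v r c ≡ anyᶠ m (λ j → (r <F j) ∧ (app v j <F app v r) ∧ (app v j =F c))
Rothe-anyᶠ {m} v r c = any-allFin m _

Rothe-inversions : ∀ {m} (v : Permutation′ m) r c → Rothe v r c ≡ (r <F app (inv v) c) ∧ (c <F app v r)
Rothe-inversions {m} v r c = ⇔→≡ (mk⇔ to from)
  where
  v⁻¹ = app (inv v)
  to : Rothe v r c ≡ true → (r <F v⁻¹ c) ∧ (c <F app v r) ≡ true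
  to h with anyᶠ⇒∃ m _ (trans (sym (Rothe-anyᶠ v r c)) h)
  ... | j , hj with ∧-≡true {r <F j} hj
  ...   | r<j , rest with ∧-≡true {app v j <F app v r} rest
  ...     | vj<vr , vj=c = subst (λ x → (r <F v⁻¹ x) ∧ (x <F app v r) ≡ true) (=F⇒≡ vj=c) at-vj
    where
    at-vj : (r <F v⁻¹ (app v j)) ∧ (app v j <F app v r) ≡ true
    at-vj rewrite inverseˡ v {j} | r<j = vj<vr
  from : (r <F v⁻¹ c) ∧ (c <F app v r) ≡ true → Rothe v r c ≡ true
  from h with ∧-≡true {r <F v⁻¹ c} h
  ... | r<v⁻¹c , c<vr = trans (Rothe-anyᶠ v r c) (∃⇒anyᶠ m _ (v⁻¹ c) witness)
    where
    witness : (r <F v⁻¹ c) ∧ (app v (v⁻¹ c) <F app v r) ∧ (app v (v⁻¹ c) =F c) ≡ true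
    witness rewrite inverseʳ v {c} | r<v⁻¹c | c<vr = =F-refl c

Rothe-inv : ∀ {m} (v : Permutation′ m) r c → Rothe (inv v) r c ≡ Rothe v c r
Rothe-inv v r c = begin
  Rothe (inv v) r c                           ≡⟨ Rothe-inversions (inv v) r c ⟩
  (r <F app v c) ∧ (c <F app (inv v) r)       ≡⟨ ∧-comm (r <F app v c) (c <F app (inv v) r) ⟩
  (c <F app (inv v) r) ∧ (r <F app v c)       ≡⟨ Rothe-inversions v c r ⟨
  Rothe v c r                                 ∎
  where open ≡-Reasoning

any-column : ∀ {m} (L : List (Cell m)) c (P : Fin m → Bool) →
             any (λ x → (proj₂ x =F c) ∧ P (proj₂ x)) L ≡ P c ∧ occupied L c
any-column []       c P = sym (∧-zeroʳ (P c))
any-column (x ∷ L) c P with proj₂ x =F c in e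
... | true  = trans (cong₂ (λ z y → P z ∨ y) (=F⇒≡ e) (any-column L c P))
                   (trans (∨-abs-∧ (P c) _) (sym (∧-identityʳ (P c))))
... | false = any-column L c P

d-countᶠ : ∀ {m} n (u : Permutation′ m) → d n u ≡ countᶠ m (λ c → not (toℕ c <ᵇ n) ∧ occupied (dark (Rothe u)) c)
d-countᶠ {m} n u =
  trans (count-byColumn (dark (Rothe u)) (foldr-darkStep-columnsDistinct (Rothe u) (allFin m)) (λ x → n <ᵇ suc (toℕ (proj₂ x))))
        (countᶠ-cong m (λ c → trans (any-column (dark (Rothe u)) c (λ z → n <ᵇ suc (toℕ z)))
                                    (cong (_∧ occupied (dark (Rothe u)) c) (<ᵇ-suc n (toℕ c)))))

ext-insertBump : ∀ {k} (a : Fin (suc k)) (f : Fin (suc k) → ℕ) (g : Fin k → ℕ) x → f a ≡ x →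
                 (∀ r → f (punchIn a r) ≡ fromBool (toℕ r <ᵇ toℕ a) + g r) →
                 ∀ n → ext f n ≡ insertBump (toℕ a) x (ext g) n
ext-insertBump fzero          f g x fa≡x f-punchIn zero    = fa≡x
ext-insertBump fzero          f g x fa≡x f-punchIn (suc n) = ext-cong f-punchIn n
ext-insertBump {suc k} (fsuc a) f g x fa≡x f-punchIn zero    = f-punchIn fzero
ext-insertBump {suc k} (fsuc a) f g x fa≡x f-punchIn (suc n) =
  ext-insertBump a (f ∘ fsuc) (g ∘ fsuc) x fa≡x (f-punchIn ∘ fsuc) n

-- snow v r c unfolds to Rothe v r c ∨ any (darkBelow r c) (dark (Rothe v)).
darkBelow : ∀ {m} → Fin m → Fin m → Cell m → Bool
darkBelow r′ c′ x = (proj₂ x =F c′) ∧ (r′ <F proj₁ x)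

module Prepended {m} (w : Permutation′ (suc m)) (u : Permutation′ m)
  (w-suc : ∀ i → app w (fsuc i) ≡ punchIn (app w fzero) (app u i)) where

  a : Fin (suc m)
  a = app w fzero

  w⁻¹-a : app (inv w) a ≡ fzero
  w⁻¹-a = inverseˡ w

  w⁻¹-punchIn : ∀ c → app (inv w) (punchIn a c) ≡ fsuc (app (inv u) c)
  w⁻¹-punchIn c = begin
    app (inv w) (punchIn a c)                          ≡⟨ cong (app (inv w) ∘ punchIn a) (inverseʳ u) ⟨
    app (inv w) (punchIn a (app u (app (inv u) c)))    ≡⟨ cong (app (inv w)) (w-suc (app (inv u) c)) ⟨
    app (inv w) (app w (fsuc (app (inv u) c)))         ≡⟨ inverseˡ w ⟩
    fsuc (app (inv u) c)                               ∎
    where open ≡-Reasoning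

  Rothe-w-suc : ∀ r c → Rothe w (fsuc r) (punchIn a c) ≡ Rothe u r c
  Rothe-w-suc r c = begin
    Rothe w (fsuc r) (punchIn a c)                                             ≡⟨ Rothe-inversions w (fsuc r) (punchIn a c) ⟩
    (fsuc r <F app (inv w) (punchIn a c)) ∧ (punchIn a c <F app w (fsuc r))    ≡⟨ cong₂ (λ x y → (fsuc r <F x) ∧ (punchIn a c <F y))
                                                                                         (w⁻¹-punchIn c) (w-suc r) ⟩
    (r <F app (inv u) c) ∧ (punchIn a c <F punchIn a (app u r))                 ≡⟨ cong ((r <F app (inv u) c) ∧_) (punchIn-<F a c (app u r)) ⟩
    (r <F app (inv u) c) ∧ (c <F app u r)                                      ≡⟨ Rothe-inversions u r c ⟨
    Rothe u r c                                                                ∎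
    where open ≡-Reasoning

  Rothe-w-pivotColumn : ∀ r → Rothe w (fsuc r) a ≡ false
  Rothe-w-pivotColumn r rewrite Rothe-inversions w (fsuc r) a | w⁻¹-a = refl

  Rothe-w-top : ∀ c′ → Rothe w fzero c′ ≡ (c′ <F a)
  Rothe-w-top c′ rewrite Rothe-inversions w fzero c′ with app (inv w) c′ in e
  ... | fsuc _ = refl
  ... | fzero  = sym (subst (λ x → (x <F a) ≡ false) (trans (cong (app w) (sym e)) (inverseʳ w)) (<ᵇ-irrefl (toℕ a)))

  Rothe-w⁻¹-punchIn : ∀ r c → Rothe (inv w) (punchIn a r) (fsuc c) ≡ Rothe (inv u) r c
  Rothe-w⁻¹-punchIn r c = trans (Rothe-inv w (punchIn a r) (fsuc c)) (trans (Rothe-w-suc c r) (sym (Rothe-inv u r c)))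

  Rothe-w⁻¹-firstColumn : ∀ r → Rothe (inv w) (punchIn a r) fzero ≡ (toℕ r <ᵇ toℕ a)
  Rothe-w⁻¹-firstColumn r = trans (Rothe-inv w (punchIn a r) fzero) (trans (Rothe-w-top (punchIn a r)) (punchIn-<ᵇ-pivot a r))

  Rothe-w⁻¹-pivotRow : ∀ c′ → Rothe (inv w) a c′ ≡ false
  Rothe-w⁻¹-pivotRow fzero    = trans (Rothe-inv w a fzero) (trans (Rothe-w-top a) (<ᵇ-irrefl (toℕ a)))
  Rothe-w⁻¹-pivotRow (fsuc r) = trans (Rothe-inv w a (fsuc r)) (Rothe-w-pivotColumn r)

  punchIn-image? : ∀ c′ → Σ (Fin m) (λ c → punchIn a c ≡ c′) ⊎ (∀ c → punchIn a c ≢ c′)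
  punchIn-image? c′ with a ≟ c′
  ... | yes refl = inj₂ (punchInᵢ≢i a)
  ... | no a≢c′  = inj₁ (punchOut a≢c′ , punchIn-punchOut a≢c′)

  Rothe-w-offImage : ∀ r c′ → (∀ c → punchIn a c ≢ c′) → Rothe w (fsuc r) c′ ≡ true → ⊥
  Rothe-w-offImage r c′ c′∉ cell with a ≟ c′
  ... | yes refl = true≢false (trans (sym cell) (Rothe-w-pivotColumn r))
  ... | no a≢c′  = c′∉ (punchOut a≢c′) (punchIn-punchOut a≢c′)

  module Emb = DarkEmbedding (Rothe u) (Rothe w) fsuc (punchIn a) (punchIn-<F a) (punchIn-=F a) punchIn-image?
                             Rothe-w-suc (λ r c′ c′∉ cell → ⊥-elim (Rothe-w-offImage r c′ c′∉ cell))

  -- Row 1 of w is scanned last, so dark(Rothe w) is darkStep (Rothe w) fzero applied to this.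
  darkBelowTop : List (Cell (suc m))
  darkBelowTop = foldr (darkStep (Rothe w)) [] (tabulate fsuc)

  any-dark-w : ∀ (q′ : Cell (suc m) → Bool) (q : Cell m → Bool) → (∀ c → q′ (fzero , c) ≡ false) →
               (∀ r c → q′ (fsuc r , punchIn a c) ≡ q (r , c)) → any q′ (dark (Rothe w)) ≡ any q (dark (Rothe u))
  any-dark-w q′ q top below =
    trans (darkStep-any (Rothe w) fzero darkBelowTop q′ top)
          (Emb.any-Lifts q′ q below (λ r c′ c′∉ cell → ⊥-elim (Rothe-w-offImage r c′ c′∉ cell))
                        (Emb.foldr-darkStep-Lifts (Emb.rowsMatch-tabulate fsuc id (λ _ → refl))))

  snow-w-suc : ∀ r c → snow w (fsuc r) (punchIn a c) ≡ snow u r c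
  snow-w-suc r c = cong₂ _∨_ (Rothe-w-suc r c)
    (any-dark-w (darkBelow (fsuc r) (punchIn a c)) (darkBelow r c) (λ _ → ∧-zeroʳ _)
                (λ r₀ c₀ → cong (_∧ (r <F r₀)) (punchIn-=F a c₀ c)))

  snow-w-suc-pivot : ∀ r → snow w (fsuc r) a ≡ false
  snow-w-suc-pivot r = cong₂ _∨_ (Rothe-w-pivotColumn r)
    (trans (any-dark-w (darkBelow (fsuc r) a) (λ _ → false) (λ _ → ∧-zeroʳ _)
                       (λ r₀ c₀ → cong (_∧ (r <F r₀)) (punchInᵢ=Fi a c₀)))
           (any-false (dark (Rothe u))))

  snow-w-top : ∀ c → snow w fzero (punchIn a c) ≡ (toℕ c <ᵇ toℕ a) ∨ occupied (dark (Rothe u)) c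
  snow-w-top c = cong₂ _∨_ (trans (Rothe-w-top (punchIn a c)) (punchIn-<ᵇ-pivot a c))
    (any-dark-w (darkBelow fzero (punchIn a c)) (λ x → proj₂ x =F c) (λ _ → ∧-zeroʳ _)
                (λ r₀ c₀ → trans (∧-identityʳ _) (punchIn-=F a c₀ c)))

  snow-w-top-pivot : snow w fzero a ≡ false
  snow-w-top-pivot = cong₂ _∨_ (trans (Rothe-w-top a) (<ᵇ-irrefl (toℕ a)))
    (trans (any-dark-w (darkBelow fzero a) (λ _ → false) (λ _ → ∧-zeroʳ _)
                       (λ r₀ c₀ → trans (∧-identityʳ _) (punchInᵢ=Fi a c₀)))
           (any-false (dark (Rothe u))))

  rajcode-w-suc : ∀ k → rajcode w (suc k) ≡ rajcode u k
  rajcode-w-suc = ext-cong rowCount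
    where
    rowCount : ∀ r → count (snow w (fsuc r)) (allFin (suc m)) ≡ count (snow u r) (allFin m)
    rowCount r = begin
      count (snow w (fsuc r)) (allFin (suc m))                                     ≡⟨ count-allFin (suc m) (snow w (fsuc r)) ⟩
      countᶠ (suc m) (snow w (fsuc r))                                             ≡⟨ countᶠ-punchIn m a (snow w (fsuc r)) ⟩
      fromBool (snow w (fsuc r) a) + countᶠ m (snow w (fsuc r) ∘ punchIn a)        ≡⟨ cong₂ _+_ (cong fromBool (snow-w-suc-pivot r))
                                                                                              (countᶠ-cong m (snow-w-suc r)) ⟩
      countᶠ m (snow u r)                                                          ≡⟨ count-allFin m (snow u r) ⟨
      count (snow u r) (allFin m)                                                  ∎
      where open ≡-Reasoning

  rajcode-w-zero : rajcode w 0 ≡ toℕ a + d (toℕ a) u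
  rajcode-w-zero = begin
    count (snow w fzero) (allFin (suc m))                                ≡⟨ count-allFin (suc m) (snow w fzero) ⟩
    countᶠ (suc m) (snow w fzero)                                        ≡⟨ countᶠ-punchIn m a (snow w fzero) ⟩
    fromBool (snow w fzero a) + countᶠ m (snow w fzero ∘ punchIn a)      ≡⟨ cong₂ _+_ (cong fromBool snow-w-top-pivot) (countᶠ-cong m snow-w-top) ⟩
    countᶠ m (λ c → (toℕ c <ᵇ toℕ a) ∨ occupied (dark (Rothe u)) c)
      ≡⟨ countᶠ-+ m (λ c → fromBool-∨-not (toℕ c <ᵇ toℕ a) (occupied (dark (Rothe u)) c)) ⟩
    countᶠ m (λ c → toℕ c <ᵇ toℕ a) + countᶠ m (λ c → not (toℕ c <ᵇ toℕ a) ∧ occupied (dark (Rothe u)) c)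
      ≡⟨ cong₂ _+_ (countᶠ-<ᵇ m (toℕ a) (toℕ≤pred[n] a)) (sym (d-countᶠ (toℕ a) u)) ⟩
    toℕ a + d (toℕ a) u                                                  ∎
    where open ≡-Reasoning

  fsuc-image? : ∀ c′ → Σ (Fin m) (λ c → fsuc c ≡ c′) ⊎ (∀ c → fsuc c ≢ c′)
  fsuc-image? fzero    = inj₂ (λ c ())
  fsuc-image? (fsuc c) = inj₁ (c , refl)

  firstColumn-left : ∀ r c′ → (∀ c → fsuc c ≢ c′) → Rothe (inv w) (punchIn a r) c′ ≡ true → ∀ (c : Fin m) → toℕ c′ < toℕ (fsuc c)
  firstColumn-left r fzero     _   _ c = s≤s z≤n
  firstColumn-left r (fsuc c′) c′∉ _ c = ⊥-elim (c′∉ c′ refl)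

  module Emb⁻¹ = DarkEmbedding (Rothe (inv u)) (Rothe (inv w)) (punchIn a) fsuc
                              (λ (x y : Fin m) → refl) (λ (x y : Fin m) → refl) fsuc-image? Rothe-w⁻¹-punchIn firstColumn-left

  extra-cell : ∀ r₀ c′ → (∀ c → fsuc c ≢ c′) → Rothe (inv w) (punchIn a r₀) c′ ≡ true → (c′ ≡ fzero) × (toℕ r₀ < toℕ a)
  extra-cell r₀ fzero    _   cell = refl , <ᵇ≡true⇒< (trans (sym (Rothe-w⁻¹-firstColumn r₀)) cell)
  extra-cell r₀ (fsuc c) c′∉ _    = ⊥-elim (c′∉ c refl)

  any-dark-w⁻¹ : ∀ (q′ : Cell (suc m) → Bool) (q : Cell m → Bool) → (∀ r c → q′ (punchIn a r , fsuc c) ≡ q (r , c)) →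
                 (∀ r₀ → toℕ r₀ < toℕ a → q′ (punchIn a r₀ , fzero) ≡ false) → any q′ (dark (Rothe (inv w))) ≡ any q (dark (Rothe (inv u)))
  any-dark-w⁻¹ q′ q onImage firstColumn = Emb⁻¹.any-Lifts q′ q onImage extra
    (Emb⁻¹.foldr-darkStep-Lifts (Emb⁻¹.rowsMatch-punchIn a id id (λ _ → refl) Rothe-w⁻¹-pivotRow))
    where
    extra : ∀ r₀ c′ → (∀ c → fsuc c ≢ c′) → Rothe (inv w) (punchIn a r₀) c′ ≡ true → q′ (punchIn a r₀ , c′) ≡ false
    extra r₀ c′ c′∉ cell with extra-cell r₀ c′ c′∉ cell
    ... | c′≡0 , r₀<a = subst (λ z → q′ (punchIn a r₀ , z) ≡ false) (sym c′≡0) (firstColumn r₀ r₀<a)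

  snow-w⁻¹-punchIn : ∀ r c → snow (inv w) (punchIn a r) (fsuc c) ≡ snow (inv u) r c
  snow-w⁻¹-punchIn r c = cong₂ _∨_ (Rothe-w⁻¹-punchIn r c)
    (any-dark-w⁻¹ (darkBelow (punchIn a r) (fsuc c)) (darkBelow r c)
                  (λ r₀ c₀ → cong ((c₀ =F c) ∧_) (punchIn-<F a r r₀)) (λ _ _ → refl))

  snow-w⁻¹-firstColumn : ∀ r → snow (inv w) (punchIn a r) fzero ≡ (toℕ r <ᵇ toℕ a)
  snow-w⁻¹-firstColumn r rewrite Rothe-w⁻¹-firstColumn r with toℕ r <ᵇ toℕ a in r<a?
  ... | true  = refl
  ... | false = trans (any-dark-w⁻¹ (darkBelow (punchIn a r) fzero) (λ _ → false) (λ _ _ → refl) belowLater)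
                      (any-false (dark (Rothe (inv u))))
    where
    belowLater : ∀ r₀ → toℕ r₀ < toℕ a → (punchIn a r <F punchIn a r₀) ≡ false
    belowLater r₀ r₀<a = trans (punchIn-<F a r r₀) (≥⇒<ᵇ≡false (<⇒≤ (<-≤-trans r₀<a (<ᵇ≡false⇒≥ r<a?))))

  snow-w⁻¹-pivot-firstColumn : snow (inv w) a fzero ≡ false
  snow-w⁻¹-pivot-firstColumn = cong₂ _∨_ (Rothe-w⁻¹-pivotRow fzero)
    (trans (any-dark-w⁻¹ (darkBelow a fzero) (λ _ → false) (λ _ _ → refl)
                         (λ r₀ r₀<a → trans (pivot-<ᵇ-punchIn a r₀) (≥⇒<ᵇ≡false r₀<a)))
           (any-false (dark (Rothe (inv u)))))

  aboveRow : Cell m → Bool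
  aboveRow x = toℕ a <ᵇ suc (toℕ (proj₁ x))

  snow-w⁻¹-pivot : ∀ c → snow (inv w) a (fsuc c) ≡ any (λ x → (proj₂ x =F c) ∧ aboveRow x) (dark (Rothe (inv u)))
  snow-w⁻¹-pivot c = cong₂ _∨_ (Rothe-w⁻¹-pivotRow (fsuc c))
    (any-dark-w⁻¹ (darkBelow a (fsuc c)) (λ x → (proj₂ x =F c) ∧ aboveRow x)
                  (λ r₀ c₀ → cong ((c₀ =F c) ∧_) (pivot-<ᵇ-punchIn a r₀)) (λ _ _ → refl))

  rajcode-w⁻¹ : ∀ k → rajcode (inv w) k ≡ insertBump (toℕ a) (d (toℕ a) u) (rajcode (inv u)) k
  rajcode-w⁻¹ = ext-insertBump a _ _ _ pivotRow otherRow
    where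
    open ≡-Reasoning
    otherRow : ∀ r → count (snow (inv w) (punchIn a r)) (allFin (suc m)) ≡ fromBool (toℕ r <ᵇ toℕ a) + count (snow (inv u) r) (allFin m)
    otherRow r = begin
      count (snow (inv w) (punchIn a r)) (allFin (suc m))    ≡⟨ count-allFin (suc m) (snow (inv w) (punchIn a r)) ⟩
      countᶠ (suc m) (snow (inv w) (punchIn a r))            ≡⟨ cong₂ _+_ (cong fromBool (snow-w⁻¹-firstColumn r))
                                                                          (countᶠ-cong m (snow-w⁻¹-punchIn r)) ⟩
      fromBool (toℕ r <ᵇ toℕ a) + countᶠ m (snow (inv u) r)  ≡⟨ cong (fromBool (toℕ r <ᵇ toℕ a) +_) (count-allFin m (snow (inv u) r)) ⟨
      fromBool (toℕ r <ᵇ toℕ a) + count (snow (inv u) r) (allFin m) ∎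
    pivotRow : count (snow (inv w) a) (allFin (suc m)) ≡ d (toℕ a) u
    pivotRow = begin
      count (snow (inv w) a) (allFin (suc m))                                  ≡⟨ count-allFin (suc m) (snow (inv w) a) ⟩
      countᶠ (suc m) (snow (inv w) a)                                          ≡⟨ cong₂ _+_ (cong fromBool snow-w⁻¹-pivot-firstColumn)
                                                                                            (countᶠ-cong m snow-w⁻¹-pivot) ⟩
      countᶠ m (λ c → any (λ x → (proj₂ x =F c) ∧ aboveRow x) (dark (Rothe (inv u))))
        ≡⟨ count-byColumn (dark (Rothe (inv u))) (foldr-darkStep-columnsDistinct (Rothe (inv u)) (allFin m)) aboveRow ⟨
      count aboveRow (dark (Rothe (inv u)))                                    ≡⟨ count-dark-transpose (Rothe u) (Rothe (inv u)) (Rothe-inv u) aboveRow ⟩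
      d (toℕ a) u                                                              ∎

invcode-head : ∀ {m} (w : Permutation′ (suc m)) → invcode w 0 ≡ toℕ (app w fzero)
invcode-head = codeAt-zero

invcode-tail-punchIn : ∀ {m} (w : Permutation′ (suc m)) (u : Permutation′ m) → (∀ k → invcode u k ≡ invcode w (suc k)) →
                       ∀ i → app w (fsuc i) ≡ punchIn (app w fzero) (app u i)
invcode-tail-punchIn {m} w u tail i =
  trans (punchIn-permute w fzero i) (cong (punchIn (app w fzero)) (codeAt-injective m (remove fzero w) u sameCode i))
  where
  sameCode : ∀ j → codeAt (remove fzero w) j ≡ codeAt u j
  sameCode j = begin
    codeAt (remove fzero w) j     ≡⟨ codeAt-suc w j ⟨
    codeAt w (fsuc j)             ≡⟨ ext-toℕ (codeAt w ∘ fsuc) j ⟨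
    invcode w (suc (toℕ j))       ≡⟨ tail (toℕ j) ⟨
    invcode u (toℕ j)             ≡⟨ ext-toℕ (codeAt u) j ⟩
    codeAt u j                    ∎
    where open ≡-Reasoning

sumUpTo-cong : ∀ n {f g : WeakComp} → (∀ k → f k ≡ g k) → sumUpTo n f ≡ sumUpTo n g
sumUpTo-cong zero    f≗g = refl
sumUpTo-cong (suc n) f≗g = cong₂ _+_ (f≗g 0) (sumUpTo-cong n (f≗g ∘ suc))

prepend-difference : ∀ a x r i → (ℤ.+ (a + x + r) ℤ.- ℤ.+ (a + i)) ℤ.- (ℤ.+ r ℤ.- ℤ.+ i) ≡ ℤ.+ x
prepend-difference a x r i rewrite ℤ.pos-+ (a + x) r | ℤ.pos-+ a x | ℤ.pos-+ a i = cancel (ℤ.+ a) (ℤ.+ x) (ℤ.+ r) (ℤ.+ i)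
  where cancel : ∀ (a x r i : ℤ.ℤ) → (a ℤ.+ x ℤ.+ r ℤ.- (a ℤ.+ i)) ℤ.- (r ℤ.- i) ≡ x
        cancel = solve-∀

reg-prepend : ∀ {m} (w : Permutation′ (suc m)) (u : Permutation′ m) x →
              (∀ k → rajcode w k ≡ prepend (invcode w 0 + x) (rajcode u) k) → (∀ k → invcode u k ≡ invcode w (suc k)) →
              reg w ℤ.- reg u ≡ ℤ.+ x
reg-prepend {m} w u x raj tail =
  trans (cong (ℤ._- reg u) reg-w) (prepend-difference (invcode w 0) x (sumUpTo m (rajcode u)) (sumUpTo m (invcode u)))
  where
  reg-w : reg w ≡ ℤ.+ (invcode w 0 + x + sumUpTo m (rajcode u)) ℤ.- ℤ.+ (invcode w 0 + sumUpTo m (invcode u))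
  reg-w = cong₂ (λ r i → ℤ.+ r ℤ.- ℤ.+ i) (cong₂ _+_ (raj 0) (sumUpTo-cong m (raj ∘ suc)))
                                          (cong (invcode w 0 +_) (sumUpTo-cong m (sym ∘ tail)))

proposition3p2 : (m : ℕ) → 1 ≤ m → (w : Permutation′ (suc m)) → (u : Permutation′ m) →
    (∀ k → invcode u k ≡ invcode w (suc k)) →
      (∀ k → rajcode w k ≡ prepend (invcode w 0 + d (invcode w 0) u) (rajcode u) k)
      × (∀ k → rajcode (inv w) k ≡ insertBump (invcode w 0) (d (invcode w 0) u) (rajcode (inv u)) k)
      × (reg w ℤ.- reg u ≡ ℤ.+ d (invcode w 0) u)
proposition3p2 m _ w u tail = rajcode-w , rajcode-w⁻¹′ , reg-prepend w u (d (invcode w 0) u) rajcode-w tail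
  where
  open Prepended w u (invcode-tail-punchIn w u tail)
  rajcode-w : ∀ k → rajcode w k ≡ prepend (invcode w 0 + d (invcode w 0) u) (rajcode u) k
  rajcode-w zero    rewrite invcode-head w = rajcode-w-zero
  rajcode-w (suc k) = rajcode-w-suc k
  rajcode-w⁻¹′ : ∀ k → rajcode (inv w) k ≡ insertBump (invcode w 0) (d (invcode w 0) u) (rajcode (inv u)) k
  rajcode-w⁻¹′ rewrite invcode-head w = rajcode-w⁻¹
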